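{- For every graph $G$ and all $d,d'\in\mathbb{N}_+$, there is a graph homomorphism $(G/d')\ltimes d\to (G\ltimes d)/d'$.
   Context: Graphs are undirected simple graphs, possibly infinite. The lexicographic product $G\ltimes H$ has vertex set $V(G)\times V(H)$ with $(v,w)\sim(v',w')$ iff $v\sim v'$, or $v=v'$ and $w\sim w'$. The $d$-fold blowup is $G\ltimes d:=G\ltimes K_d$. The $d$-fractionalization $G/d$ is the graph whose vertices are the $d$-cliques of $G$, with $S\sim T$ iff $S\cap T=\emptyset$ and $s\sim t$ for all $s\in S,t\in T$. -}

module Defs where

open import Data.Nat using (ℕ; suc; NonZero)
open import Data.Fin using (Fin; zero)
open import Data.Product using (Σ; ∃; _×_; _,_)
open import Data.Sum using (_⊎_)
open import Relation.Nullary using (¬_)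
open import Relation.Binary using (IsEquivalence)
open import Relation.Binary.PropositionalEquality using (_≡_; _≢_; refl; sym; trans; cong)
open import Data.Sum using (inj₁; inj₂)
open import Data.Product using (proj₁; proj₂)

-- Vertices form a setoid
-- (so that e.g. vertices of G/d, which are SETS of vertices, can be
-- identified up to equality of sets); adjacency respects vertex equality,
-- is symmetric and irreflexive (no loops).
record Graph : Set₁ where
  field
    V      : Set
    _≈_    : V → V → Set
    ≈-equiv : IsEquivalence _≈_
    _∼_    : V → V → Set
    ∼-resp : ∀ {x x' y y'} → x ≈ x' → y ≈ y' → x ∼ y → x' ∼ y'
    ∼-sym  : ∀ {x y} → x ∼ y → y ∼ x
    ∼-irr  : ∀ {x y} → x ∼ y → ¬ (x ≈ y)

open Graph public

record Hom (G H : Graph) : Set where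
  field
    fun      : V G → V H
    fun-cong : ∀ {x y} → _≈_ G x y → _≈_ H (fun x) (fun y)
    fun-adj  : ∀ {x y} → _∼_ G x y → _∼_ H (fun x) (fun y)

K : ℕ → Graph
K d = record
  { V = Fin d
  ; _≈_ = _≡_
  ; ≈-equiv = record { refl = refl ; sym = sym ; trans = trans }
  ; _∼_ = _≢_
  ; ∼-resp = λ { refl refl p → p }
  ; ∼-sym = λ p q → p (sym q)
  ; ∼-irr = λ p → p
  }

_⋉_ : Graph → Graph → Graph
G ⋉ H = record
  { V = V G × V H
  ; _≈_ = λ { (v , w) (v' , w') → _≈_ G v v' × _≈_ H w w' }
  ; ≈-equiv = record
      { refl = IsEquivalence.refl (≈-equiv G) , IsEquivalence.refl (≈-equiv H)
      ; sym = λ { (p , q) → IsEquivalence.sym (≈-equiv G) p , IsEquivalence.sym (≈-equiv H) q }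
      ; trans = λ { (p , q) (p' , q') → IsEquivalence.trans (≈-equiv G) p p' , IsEquivalence.trans (≈-equiv H) q q' }
      }
  ; _∼_ = λ { (v , w) (v' , w') → _∼_ G v v' ⊎ (_≈_ G v v' × _∼_ H w w') }
  ; ∼-resp = λ { (a , b) (c , e) (inj₁ p) → inj₁ (∼-resp G a c p)
               ; (a , b) (c , e) (inj₂ (p , q)) → inj₂
                   ( IsEquivalence.trans (≈-equiv G) (IsEquivalence.sym (≈-equiv G) a) (IsEquivalence.trans (≈-equiv G) p c)
                   , ∼-resp H b e q) }
  ; ∼-sym = λ { (inj₁ p) → inj₁ (∼-sym G p)
              ; (inj₂ (p , q)) → inj₂ (IsEquivalence.sym (≈-equiv G) p , ∼-sym H q) }
  ; ∼-irr = λ { (inj₁ p) (a , b) → ∼-irr G p a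
              ; (inj₂ (p , q)) (a , b) → ∼-irr H q b }
  }

blowup : Graph → ℕ → Graph
blowup G d = G ⋉ K d

-- d-cliques of G: given by an enumeration f : Fin d → V G of pairwise
-- adjacent (hence pairwise distinct) vertices.  Two enumerations denote
-- the same clique (vertex of G/d) iff they have the same image.
Clique : Graph → ℕ → Set
Clique G d = Σ (Fin d → V G) (λ f → ∀ i j → i ≢ j → _∼_ G (f i) (f j))

SameSet : (G : Graph) (d : ℕ) → Clique G d → Clique G d → Set
SameSet G d (f , _) (g , _) =
  (∀ i → ∃ λ j → _≈_ G (f i) (g j)) × (∀ j → ∃ λ i → _≈_ G (g j) (f i))

-- Only defined for d ≥ 1
-- (for d = 0 the empty clique would be adjacent to itself).
frac : Graph → (d : ℕ) → .{{NonZero d}} → Graph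
frac G (suc k) = record
  { V = Clique G (suc k)
  ; _≈_ = SameSet G (suc k)
  ; ≈-equiv = record
      { refl = λ {S} → (λ i → i , ≈r) , (λ i → i , ≈r)
      ; sym = λ { (p , q) → q , p }
      ; trans = λ { (p , q) (p' , q') →
          (λ i → proj₁ (p' (proj₁ (p i))) , ≈t (proj₂ (p i)) (proj₂ (p' (proj₁ (p i)))))
        , (λ k → proj₁ (q (proj₁ (q' k))) , ≈t (proj₂ (q' k)) (proj₂ (q (proj₁ (q' k))))) }
      }
  ; _∼_ = λ { (f , _) (g , _) → (∀ i j → ¬ (_≈_ G (f i) (g j))) × (∀ i j → _∼_ G (f i) (g j)) }
  ; ∼-resp = λ { (p , q) (p' , q') (dis , adj) →
      (λ i j e → dis (proj₁ (q i)) (proj₁ (q' j))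
          (≈t (≈s (proj₂ (q i))) (≈t e (proj₂ (q' j)))))
    , (λ i j → ∼-resp G (≈s (proj₂ (q i))) (≈s (proj₂ (q' j))) (adj (proj₁ (q i)) (proj₁ (q' j)))) }
  ; ∼-sym = λ { (dis , adj) → (λ i j e → dis j i (≈s e)) , (λ i j → ∼-sym G (adj j i)) }
  ; ∼-irr = λ { (dis , adj) (p , q) → dis zero (proj₁ (p zero)) (proj₂ (p zero)) }
  }
  where
    ≈r = IsEquivalence.refl (≈-equiv G)
    ≈s = IsEquivalence.sym (≈-equiv G)
    ≈t = IsEquivalence.trans (≈-equiv G)

-- Send (S , a) to the clique S × {a}.  If S ∼ T in G/d' the tagged cliques are
-- disjoint and completely joined already in the first coordinate.  If S = T and
-- a ≠ b, two vertices (s , a) and (t , b) are adjacent in G ⋉ d because s and t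
-- are either equal (adjacent colours) or distinct members of the clique S.

module Submission where

open import Defs
open import Data.Nat using (ℕ; NonZero; suc)
open import Data.Fin using (Fin)
open import Data.Fin.Properties using (_≟_)
open import Data.Product using (_,_; proj₁; proj₂)
open import Data.Sum using (inj₁; inj₂)
open import Relation.Nullary using (yes; no)
open import Relation.Binary using (IsEquivalence)
open import Relation.Binary.PropositionalEquality using (_≡_; _≢_; refl)

module _ (G : Graph) where
  private
    module G = Graph G
    open IsEquivalence G.≈-equiv using () renaming (refl to ≈-refl; sym to ≈-sym)

  ∼-clique-member : ∀ {n} (T : Clique G n) {x} j′ j →
    x G.≈ proj₁ T j′ → j′ ≢ j → x G.∼ proj₁ T j
  ∼-clique-member (g , clique) j′ j x≈gj′ j′≢j =
    G.∼-resp (≈-sym x≈gj′) ≈-refl (clique j′ j j′≢j)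

  tag : ∀ {n} d → Clique G n → Fin d → Clique (blowup G d) n
  tag d (f , clique) a = (λ i → f i , a) , (λ i j i≢j → inj₁ (clique i j i≢j))

  tag-cong : ∀ {n} d S T {a b : Fin d} → SameSet G n S T → a ≡ b →
    SameSet (blowup G d) n (tag d S a) (tag d T b)
  tag-cong d S T (S⊆T , T⊆S) refl =
      (λ i → proj₁ (S⊆T i) , proj₂ (S⊆T i) , refl)
    , (λ j → proj₁ (T⊆S j) , proj₂ (T⊆S j) , refl)

  tag-adj-colour : ∀ {n} d S T {a b : Fin d} → SameSet G n S T → a ≢ b →
    ∀ i j → _∼_ (blowup G d) (proj₁ (tag d S a) i) (proj₁ (tag d T b) j)
  tag-adj-colour d S T (S⊆T , _) a≢b i j with S⊆T i
  ... | j′ , fi≈gj′ with j′ ≟ j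
  ...   | yes refl = inj₂ (fi≈gj′ , a≢b)
  ...   | no j′≢j  = inj₁ (∼-clique-member T j′ j fi≈gj′ j′≢j)

  tag-adj : ∀ k d S T {a b : Fin d} →
    _∼_ (blowup (frac G (suc k)) d) (S , a) (T , b) →
    _∼_ (frac (blowup G d) (suc k)) (tag d S a) (tag d T b)
  tag-adj k d S T (inj₁ (disjoint , adjacent)) =
    (λ i j fi≈gj → disjoint i j (proj₁ fi≈gj)) , (λ i j → inj₁ (adjacent i j))
  tag-adj k d S T (inj₂ (S≈T , a≢b)) =
    (λ i j fia≈gjb → a≢b (proj₂ fia≈gjb)) , tag-adj-colour d S T S≈T a≢b

lemma3p10 : (G : Graph) (d d' : ℕ) .{{_ : NonZero d}} .{{_ : NonZero d'}} →
    Hom (blowup (frac G d') d) (frac (blowup G d) d')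
lemma3p10 G d (suc k) = record
  { fun      = λ (S , a) → tag G d S a
  ; fun-cong = λ {(S , a)} {(T , b)} (S≈T , a≡b) → tag-cong G d S T S≈T a≡b
  ; fun-adj  = λ {(S , a)} {(T , b)} → tag-adj G k d S T
  }
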